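{- Let $G$ be a graph. Every cycle of $G$ which is not a cycle equivalence class contains at least two distinct path equivalence classes.
   Context: Graphs are simple and undirected, possibly infinite. Let $E_C$ be the set of edges of $G$ lying on some cycle, with the equivalence relation $e\sim f$ iff every cycle containing $e$ also contains $f$. A path equivalence class (resp. cycle equivalence class) is a path (resp. cycle) $P$ in $G$ whose edge set is an entire equivalence class of $\sim$. -}

module Defs where

open import Data.Nat using (ℕ; zero; suc)
open import Data.Fin using (Fin; zero; suc; inject₁; fromℕ)
open import Data.Product using (Σ; ∃; ∃-syntax; _×_; _,_)
open import Data.Sum using (_⊎_)
open import Relation.Binary.PropositionalEquality using (_≡_)
open import Relation.Nullary using (¬_)
open import Function.Definitions using (Injective)

record Graph : Set₁ where
  field
    V      : Set
    Adj    : V → V → Set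
    sym    : ∀ {u v} → Adj u v → Adj v u
    irrefl : ∀ v → ¬ Adj v v

module _ (G : Graph) where
  open Graph G

  -- Edges are unordered pairs {u,v}; an edge predicate is a predicate on
  -- ordered pairs (u , v) closed under swapping (all ours are).
  SameEdge : V → V → V → V → Set
  SameEdge a b u v = (a ≡ u × b ≡ v) ⊎ (a ≡ v × b ≡ u)

  record Path : Set where
    field
      k   : ℕ
      vtx : Fin (suc (suc k)) → V
      inj : Injective _≡_ _≡_ vtx
      adj : ∀ (i : Fin (suc k)) → Adj (vtx (inject₁ i)) (vtx (suc i))

  PathEdge : Path → V → V → Set
  PathEdge P u v = ∃[ i ] SameEdge (vtx (inject₁ i)) (vtx (suc i)) u v
    where open Path P

  record Cycle : Set where
    field
      k     : ℕ
      vtx   : Fin (suc (suc (suc k))) → V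
      inj   : Injective _≡_ _≡_ vtx
      adj   : ∀ (i : Fin (suc (suc k))) → Adj (vtx (inject₁ i)) (vtx (suc i))
      close : Adj (vtx (fromℕ (suc (suc k)))) (vtx zero)

  CycleEdge : Cycle → V → V → Set
  CycleEdge C u v =
    (∃[ i ] SameEdge (vtx (inject₁ i)) (vtx (suc i)) u v)
    ⊎ SameEdge (vtx (fromℕ (suc (suc k)))) (vtx zero) u v
    where open Cycle C

  InEC : V → V → Set
  InEC u v = Adj u v × ∃[ C ] CycleEdge C u v

  _∼_ : (V × V) → (V × V) → Set
  (a , b) ∼ (u , v) = ∀ (C : Cycle) → CycleEdge C a b → CycleEdge C u v

  -- S is (the edge set of) an entire equivalence class of ∼ on E_C
  IsClass : (V → V → Set) → Set
  IsClass S = ∃[ a ] ∃[ b ] (InEC a b ×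
    (∀ u v → (S u v → InEC u v × (a , b) ∼ (u , v))
           × (InEC u v × (a , b) ∼ (u , v) → S u v)))

  PathEquivClass : Path → Set
  PathEquivClass P = IsClass (PathEdge P)

  CycleEquivClass : Cycle → Set
  CycleEquivClass C = IsClass (CycleEdge C)

  -- P is contained in C (as a subgraph; P has an edge, so edge containment
  -- suffices)
  PathInCycle : Path → Cycle → Set
  PathInCycle P C = ∀ u v → PathEdge P u v → CycleEdge C u v

module Submission where

-- Index the edges of C by ℕ modulo its length n, e_i = {c_i , c_(i+1)}. If e_i ∼ e_j, no walk
-- avoiding e_i and e_j joins the two arcs of C − e_i − e_j, for together with e_i it would contain
-- a cycle through e_i missing e_j. Applied to the rest of a cycle through e_j but not e_i this makes
-- ∼ symmetric on C; applied to the arc of a cycle between e_r and e_s it shows that the classes do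
-- not cross: p < r < p' < s < p + n, e_p ∼ e_p' and e_r ∼ e_s force e_r ∼ e_p. A non-crossing
-- partition of ℤ_n with several blocks has two blocks that are intervals (inside a gap between
-- consecutive members of a block the partition restricts, so recurse into the gap), and an interval
-- block of edges is a path equivalence class.

open import Defs
open import Level using (0ℓ)
open import Axiom.ExcludedMiddle using (ExcludedMiddle)
open import Axiom.DoubleNegationElimination using (em⇒dne)
open import Data.Empty using (⊥-elim)
open import Data.Fin using (Fin; zero; suc; inject₁; fromℕ; fromℕ<; toℕ)
open import Data.Fin.Properties using (toℕ-injective; toℕ<n; toℕ-inject₁; toℕ-fromℕ<; toℕ-fromℕ)
open import Data.Nat using (ℕ; zero; suc; _+_; _*_; _∸_; _≤_; _<_; _≤?_; _<?_; z≤n; s≤s; s≤s⁻¹; z<s; NonZero; >-nonZero⁻¹)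
open import Data.Nat.DivMod
open import Data.Nat.Induction using (<-wellFounded)
open import Data.Nat.Properties
open import Data.Nat.Solver using (module +-*-Solver)
open import Data.Product using (Σ; ∃-syntax; ∃₂; _×_; _,_; proj₁; proj₂)
open import Data.Sum using (_⊎_; inj₁; inj₂)
open import Data.Unit using (⊤; tt)
open import Function using (_∘_)
open import Induction.WellFounded using (Acc; acc)
open import Relation.Binary.Definitions using (tri<; tri≈; tri>)
open import Relation.Binary.PropositionalEquality
open import Relation.Binary.Structures using (IsEquivalence)
open import Relation.Nullary using (¬_; yes; no)

%-distinct-on-window : ∀ n .{{_ : NonZero n}} {a b} → a < b → b < a + n → a % n ≢ b % n
%-distinct-on-window n {a} {b} a<b b<a+n eq with b / n ≤? a / n
... | yes b/n≤a/n = <-irrefl refl (<-≤-trans a<b (begin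
  b                   ≡⟨ m≡m%n+[m/n]*n b n ⟩
  b % n + b / n * n   ≤⟨ +-monoʳ-≤ (b % n) (*-monoˡ-≤ n b/n≤a/n) ⟩
  b % n + a / n * n   ≡⟨ cong (_+ a / n * n) eq ⟨
  a % n + a / n * n   ≡⟨ m≡m%n+[m/n]*n a n ⟨
  a                   ∎))
  where open ≤-Reasoning
... | no b/n≰a/n = <-irrefl refl (<-≤-trans b<a+n (begin
  a + n                     ≡⟨ cong (_+ n) (m≡m%n+[m/n]*n a n) ⟩
  a % n + a / n * n + n     ≡⟨ +-assoc (a % n) _ n ⟩
  a % n + (a / n * n + n)   ≡⟨ cong (a % n +_) (+-comm _ n) ⟩
  a % n + suc (a / n) * n   ≤⟨ +-mono-≤ (≤-reflexive eq) (*-monoˡ-≤ n (≰⇒> b/n≰a/n)) ⟩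
  b % n + b / n * n         ≡⟨ m≡m%n+[m/n]*n b n ⟨
  b                         ∎))
  where open ≤-Reasoning

suc-%-cong : ∀ n .{{_ : NonZero n}} {a b} → a % n ≡ b % n → suc a % n ≡ suc b % n
suc-%-cong n {a} {b} eq = begin
  suc a % n             ≡⟨ %-distribˡ-+ 1 a n ⟩
  (1 % n + a % n) % n   ≡⟨ cong (λ r → (1 % n + r) % n) eq ⟩
  (1 % n + b % n) % n   ≡⟨ %-distribˡ-+ 1 b n ⟨
  suc b % n             ∎
  where open ≡-Reasoning

%-injective-on-window : ∀ n .{{_ : NonZero n}} {p a b} → p ≤ a → a < p + n → p ≤ b → b < p + n → a % n ≡ b % n → a ≡ b
%-injective-on-window n {p} {a} {b} p≤a a<p+n p≤b b<p+n eq with <-cmp a b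
... | tri≈ _ a≡b _ = a≡b
... | tri< a<b _ _ = ⊥-elim (%-distinct-on-window n a<b (<-≤-trans b<p+n (+-monoˡ-≤ n p≤a)) eq)
... | tri> _ _ b<a = ⊥-elim (%-distinct-on-window n b<a (<-≤-trans a<p+n (+-monoˡ-≤ n p≤b)) (sym eq))

%-representative : ∀ n .{{_ : NonZero n}} p s → ∃[ s' ] p ≤ s' × s' < p + n × s' % n ≡ s % n
%-representative n p s = p + x % n , m≤m+n p _ , +-monoʳ-< p (m%n<n x n) , residue
  where
  open +-*-Solver
  open ≡-Reasoning
  x = s + (n ∸ p % n)
  rearrange : ∀ r q s t → r + q + (s + t) ≡ s + (r + t) + q
  rearrange = solve 4 (λ r q s t → r :+ q :+ (s :+ t) := s :+ (r :+ t) :+ q) refl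
  residue : (p + x % n) % n ≡ s % n
  residue = begin
    (p + x % n) % n                                     ≡⟨ %-distribˡ-+ p (x % n) n ⟩
    (p % n + x % n % n) % n                             ≡⟨ cong (λ r → (p % n + r) % n) (m%n%n≡m%n x n) ⟩
    (p % n + x % n) % n                                 ≡⟨ %-distribˡ-+ p x n ⟨
    (p + x) % n                                         ≡⟨ cong (λ r → (r + x) % n) (m≡m%n+[m/n]*n p n) ⟩
    (p % n + p / n * n + (s + (n ∸ p % n))) % n         ≡⟨ cong (_% n) (rearrange (p % n) (p / n * n) s (n ∸ p % n)) ⟩
    (s + (p % n + (n ∸ p % n)) + p / n * n) % n         ≡⟨ [m+kn]%n≡m%n (s + (p % n + (n ∸ p % n))) (p / n) n ⟩
    (s + (p % n + (n ∸ p % n))) % n                     ≡⟨ cong (λ r → (s + r) % n) (m+[n∸m]≡n (m%n≤n p n)) ⟩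
    (s + n) % n                                         ≡⟨ [m+n]%n≡m%n s n ⟩
    s % n                                               ∎

module Search (em : ExcludedMiddle 0ℓ) (P : ℕ → Set) where

  Least : ℕ → ℕ → Set
  Least a b = ∃[ m ] a ≤ m × m ≤ b × P m × (∀ {j} → a ≤ j → j < m → ¬ P j)

  Greatest : ℕ → ℕ → Set
  Greatest a b = ∃[ m ] a ≤ m × m ≤ b × P m × (∀ {j} → m < j → j ≤ b → ¬ P j)

  private
    least-below : ∀ d a → P (d + a) → Least a (d + a)
    least-below zero a pa = a , ≤-refl , ≤-refl , pa , λ a≤j j<a _ → ≤⇒≯ a≤j j<a
    least-below (suc d) a pa with em {P a}
    ... | yes pa' = a , ≤-refl , m≤n+m a (suc d) , pa' , λ a≤j j<a _ → ≤⇒≯ a≤j j<a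
    ... | no ¬pa with least-below d (suc a) (subst P (sym (+-suc d a)) pa)
    ...   | m , a<m , m≤ , pm , below = m , <⇒≤ a<m , ≤-trans m≤ (≤-reflexive (+-suc d a)) , pm , below′
      where
      below′ : ∀ {j} → a ≤ j → j < m → ¬ P j
      below′ a≤j j<m with m≤n⇒m<n∨m≡n a≤j
      ... | inj₁ a<j = below a<j j<m
      ... | inj₂ refl = ¬pa

    greatest-above : ∀ d a → P a → Greatest a (d + a)
    greatest-above zero a pa = a , ≤-refl , ≤-refl , pa , λ a<j j≤a _ → ≤⇒≯ j≤a a<j
    greatest-above (suc d) a pa with em {P (suc d + a)}
    ... | yes pb = suc d + a , m≤n+m a (suc d) , ≤-refl , pb , λ b<j j≤b _ → ≤⇒≯ j≤b b<j
    ... | no ¬pb with greatest-above d a pa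
    ...   | m , a≤m , m≤ , pm , above = m , a≤m , m≤n⇒m≤1+n m≤ , pm , above′
      where
      above′ : ∀ {j} → m < j → j ≤ suc d + a → ¬ P j
      above′ m<j j≤b with m≤n⇒m<n∨m≡n j≤b
      ... | inj₁ j<b = above m<j (s≤s⁻¹ j<b)
      ... | inj₂ refl = ¬pb

  least : ∀ {a b} → a ≤ b → P b → Least a b
  least {a} {b} a≤b pb = subst (Least a) (m∸n+n≡m a≤b) (least-below (b ∸ a) a (subst P (sym (m∸n+n≡m a≤b)) pb))

  greatest : ∀ {a b} → a ≤ b → P a → Greatest a b
  greatest {a} {b} a≤b pa = subst (Greatest a) (m∸n+n≡m a≤b) (greatest-above (b ∸ a) a pa)

module NonCrossing
  (em : ExcludedMiddle 0ℓ) (n : ℕ) .{{_ : NonZero n}}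
  (R : ℕ → ℕ → Set) (R-isEquivalence : IsEquivalence R)
  (R-resp-% : ∀ {i j j'} → j % n ≡ j' % n → R i j → R i j')
  (noncrossing : ∀ {p r p' s} → p < r → r < p' → p' < s → s < p + n → R p p' → R r s → R r p)
  where

  open IsEquivalence R-isEquivalence renaming (refl to R-refl; sym to R-sym; trans to R-trans)
  open Search em using (least; greatest)

  private
    dne : ∀ {P : Set} → ¬ ¬ P → P
    dne = em⇒dne em

  _≡ₙ_ : ℕ → ℕ → Set
  a ≡ₙ b = a % n ≡ b % n

  R-+n : ∀ {i j} → R i j → R i (j + n)
  R-+n {j = j} = R-resp-% (sym ([m+n]%n≡m%n j n))

  Gap : ℕ → ℕ → ℕ → Set
  Gap q p p' = R q p × R q p' × suc p < p' × (∀ {j} → p < j → j < p' → ¬ R q j)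

  Closed : ℕ → ℕ → Set
  Closed lo hi = ∀ {r s} → lo < r → r < hi → R r s → ∃[ t ] lo < t × t < hi × t ≡ₙ s

  Enclosed : ℕ → ℕ → Set
  Enclosed q m = q ≤ m × m + 2 ≤ q + n × R q m × (∀ {j} → R q j → ∃[ t ] q ≤ t × t ≤ m × t ≡ₙ j)

  record IntervalClass : Set where
    field
      start end : ℕ
      start≤end : start ≤ end
      short     : end + 2 ≤ start + n
      covers    : ∀ {j} → R start j → ∃[ t ] start ≤ t × t ≤ end × t ≡ₙ j
      filled    : ∀ {t} → start ≤ t → t ≤ end → R start t

  open IntervalClass

  find-gap : ∀ {q a b t} → a ≤ t → t ≤ b → R q a → R q b → ¬ R q t →
             ∃₂ λ p p' → a ≤ p × p' ≤ b × Gap q p p'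
  find-gap {q} a≤t t≤b rqa rqb ¬rqt with least (λ x → ¬ R q x) a≤t ¬rqt
  ... | u , a≤u , u≤t , ¬rqu , before with m≤n⇒m<n∨m≡n a≤u
  ...   | inj₂ refl = ⊥-elim (¬rqu rqa)
  ...   | inj₁ (s≤s {n = p} a≤p) with least (R q) (≤-trans u≤t t≤b) rqb
  ...     | p' , u≤p' , p'≤b , rqp' , empty with m≤n⇒m<n∨m≡n u≤p'
  ...       | inj₂ refl = ⊥-elim (¬rqu rqp')
  ...       | inj₁ u<p' = p , p' , a≤p , p'≤b , (dne (before a≤p ≤-refl) , rqp' , u<p' , empty)

  gap-bound : ∀ {q p p'} → Gap q p p' → p' ≤ p + n
  gap-bound {p = p} {p'} (rqp , _ , _ , empty) with p' ≤? p + n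
  ... | yes p'≤p+n = p'≤p+n
  ... | no p'≰p+n = ⊥-elim (empty (m<m+n p (>-nonZero⁻¹ n)) (≰⇒> p'≰p+n) (R-+n rqp))

  gap⇒closed : ∀ {q p p'} → Gap q p p' → Closed p p'
  gap⇒closed {q} {p} {p'} (rqp , rqp' , _ , empty) {r} {s} p<r r<p' rrs = locate (%-representative n p s)
    where
    rpp' : R p p'
    rpp' = R-trans (R-sym rqp) rqp'
    ¬rrp : ¬ R r p
    ¬rrp rrp = empty p<r r<p' (R-trans rqp (R-sym rrp))
    locate : ∃[ s' ] p ≤ s' × s' < p + n × s' ≡ₙ s → ∃[ t ] p < t × t < p' × t ≡ₙ s
    locate (s' , p≤s' , s'<p+n , s'≡s) with <-cmp s' p' | R-resp-% (sym s'≡s) rrs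
    ... | tri≈ _ refl _ | rrs' = ⊥-elim (¬rrp (R-trans rrs' (R-sym rpp')))
    ... | tri> _ _ p'<s' | rrs' = ⊥-elim (¬rrp (noncrossing p<r r<p' p'<s' s'<p+n rpp' rrs'))
    ... | tri< s'<p' _ _ | rrs' with m≤n⇒m<n∨m≡n p≤s'
    ...   | inj₁ p<s' = s' , p<s' , s'<p' , s'≡s
    ...   | inj₂ refl = ⊥-elim (¬rrp rrs')

  gap⇒enclosed : ∀ {q p p'} → Gap q p p' → Enclosed p' (p + n)
  gap⇒enclosed {q} {p} {p'} gap@(rqp , rqp' , sp<p' , empty) =
    gap-bound gap , subst (_≤ p' + n) (+-comm 2 (p + n)) (+-monoˡ-≤ n sp<p') ,
    R-trans (R-sym rqp') (R-+n rqp) , covered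
    where
    covered : ∀ {j} → R p' j → ∃[ t ] p' ≤ t × t ≤ p + n × t ≡ₙ j
    covered {j} rp'j with %-representative n p' j
    ... | j' , p'≤j' , j'<p'+n , j'≡j with j' ≤? p + n
    ...   | yes j'≤p+n = j' , p'≤j' , j'≤p+n , j'≡j
    ...   | no j'≰p+n = ⊥-elim (empty p<j'-n j'-n<p' (R-resp-% j≡j'-n (R-trans rqp' rp'j)))
      where
      p+n<j' = ≰⇒> j'≰p+n
      j'-n+n : j' ∸ n + n ≡ j'
      j'-n+n = m∸n+n≡m (≤-trans (m≤n+m n p) (<⇒≤ p+n<j'))
      p<j'-n : p < j' ∸ n
      p<j'-n = +-cancelʳ-< n p (j' ∸ n) (subst (p + n <_) (sym j'-n+n) p+n<j')
      j'-n<p' : j' ∸ n < p'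
      j'-n<p' = +-cancelʳ-< n (j' ∸ n) p' (subst (_< p' + n) (sym j'-n+n) j'<p'+n)
      j≡j'-n : j ≡ₙ (j' ∸ n)
      j≡j'-n = trans (sym j'≡j) (sym (m≤n⇒[n∸m]%m≡n%m (≤-trans (m≤n+m n p) (<⇒≤ p+n<j'))))

  closed⇒enclosed : ∀ {lo hi} → Closed lo hi → suc lo < hi → hi ≤ lo + n → ∃[ m ] m < hi × Enclosed (suc lo) m
  closed⇒enclosed {lo} {suc h} closed sl<hi@(s≤s sl≤h) hi≤lo+n with greatest (R (suc lo)) sl≤h R-refl
  ... | m , sl≤m , m≤h , rm , after =
    m , s≤s m≤h , (sl≤m , subst (_≤ suc lo + n) (+-comm 2 m) (s≤s (≤-trans (s≤s m≤h) hi≤lo+n)) , rm , covered)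
    where
    covered : ∀ {j} → R (suc lo) j → ∃[ t ] suc lo ≤ t × t ≤ m × t ≡ₙ j
    covered rj with closed ≤-refl sl<hi rj
    ... | t , lo<t , t<hi , t≡j with m <? t
    ...   | yes m<t = ⊥-elim (after m<t (s≤s⁻¹ t<hi) (R-resp-% (sym t≡j) rj))
    ...   | no m≮t = t , lo<t , ≮⇒≥ m≮t , t≡j

  enclosed⇒interval-class : ∀ {q m} → Acc _<_ m → Enclosed q m → Σ IntervalClass λ I → q ≤ start I × end I ≤ m
  enclosed⇒interval-class {q} {m} (acc smaller) (q≤m , short , rqm , covers)
    with em {∃[ t ] q ≤ t × t ≤ m × ¬ R q t}
  ... | no none =
    record { start = q ; end = m ; start≤end = q≤m ; short = short ; covers = covers ; filled = filled-arc } , ≤-refl , ≤-refl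
    where
    filled-arc : ∀ {t} → q ≤ t → t ≤ m → R q t
    filled-arc q≤t t≤m = dne λ ¬rqt → none (_ , q≤t , t≤m , ¬rqt)
  ... | yes (t , q≤t , t≤m , ¬rqt) with find-gap q≤t t≤m R-refl rqm ¬rqt
  ...   | p , p' , q≤p , p'≤m , gap@(_ , _ , sp<p' , _) with closed⇒enclosed (gap⇒closed gap) sp<p' (gap-bound gap)
  ...     | m' , m'<p' , enc' with enclosed⇒interval-class (smaller (<-≤-trans m'<p' p'≤m)) enc'
  ...       | I , sp≤start , end≤m' = I , ≤-trans (m≤n⇒m≤1+n q≤p) sp≤start , ≤-trans end≤m' (<⇒≤ m'<m)
    where m'<m = <-≤-trans m'<p' p'≤m

  interval-class-inside-gap : ∀ {q p p'} → Gap q p p' → Σ IntervalClass λ I → p < start I × end I < p'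
  interval-class-inside-gap gap@(_ , _ , sp<p' , _) with closed⇒enclosed (gap⇒closed gap) sp<p' (gap-bound gap)
  ... | m , m<p' , enc with enclosed⇒interval-class (<-wellFounded m) enc
  ...   | I , sp≤start , end≤m = I , sp≤start , ≤-<-trans end≤m m<p'

  interval-class-outside-gap : ∀ {q p p'} → Gap q p p' → Σ IntervalClass λ J → p' ≤ start J × end J ≤ p + n
  interval-class-outside-gap {p = p} gap = enclosed⇒interval-class (<-wellFounded (p + n)) (gap⇒enclosed gap)

  two-interval-classes : ∀ {q t} → ¬ R q t → ∃₂ λ (I J : IntervalClass) → ¬ R (start I) (start J)
  two-interval-classes {q} {t} ¬rqt with %-representative n q t
  ... | t' , q≤t' , t'<q+n , t'≡t with find-gap q≤t' (<⇒≤ t'<q+n) R-refl (R-+n R-refl) (¬rqt ∘ R-resp-% t'≡t)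
  ...   | p , p' , _ , _ , gap with interval-class-inside-gap gap | interval-class-outside-gap gap
  ...     | I , p<sI , eI<p' | J , p'≤sJ , eJ≤p+n = I , J , distinct
    where
    distinct : ¬ R (start I) (start J)
    distinct rIJ with covers I rIJ
    ... | u , sI≤u , u≤eI , u≡sJ =
      %-distinct-on-window n (<-≤-trans (≤-<-trans u≤eI eI<p') p'≤sJ)
        (≤-<-trans (≤-trans (start≤end J) eJ≤p+n) (+-monoˡ-< n (<-≤-trans p<sI sI≤u))) u≡sJ

module Walks (G : Graph) where

  open Graph G renaming (sym to Adj-sym)

  EdgeSet : Set₁
  EdgeSet = V → V → Set

  EdgeIn : EdgeSet → V → V → Set
  EdgeIn S x y = ∀ {u v} → SameEdge G x y u v → S u v

  same-edge-refl : ∀ {x y} → SameEdge G x y x y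
  same-edge-refl = inj₁ (refl , refl)

  same-edge-swap : ∀ {x y u v} → SameEdge G x y u v → SameEdge G y x u v
  same-edge-swap (inj₁ (x≡u , y≡v)) = inj₂ (y≡v , x≡u)
  same-edge-swap (inj₂ (x≡v , y≡u)) = inj₁ (y≡u , x≡v)

  same-edge-sym : ∀ {x y u v} → SameEdge G x y u v → SameEdge G u v x y
  same-edge-sym (inj₁ (refl , refl)) = inj₁ (refl , refl)
  same-edge-sym (inj₂ (refl , refl)) = inj₂ (refl , refl)

  same-edge-trans : ∀ {x y u v u' v'} → SameEdge G x y u v → SameEdge G u v u' v' → SameEdge G x y u' v'
  same-edge-trans (inj₁ (refl , refl)) e = e
  same-edge-trans (inj₂ (refl , refl)) e = same-edge-swap e

  same-edge-adj : ∀ {x y u v} → Adj x y → SameEdge G x y u v → Adj u v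
  same-edge-adj xy (inj₁ (refl , refl)) = xy
  same-edge-adj xy (inj₂ (refl , refl)) = Adj-sym xy

  cycleEdge-resp : ∀ D {x y u v} → CycleEdge G D x y → SameEdge G x y u v → CycleEdge G D u v
  cycleEdge-resp D (inj₁ (i , e)) e' = inj₁ (i , same-edge-trans e e')
  cycleEdge-resp D (inj₂ e)       e' = inj₂ (same-edge-trans e e')

  EdgeIn-swap : ∀ {S x y} → EdgeIn S x y → EdgeIn S y x
  EdgeIn-swap h e = h (same-edge-swap e)

  infixr 5 _∷_
  data Walk : ℕ → V → V → Set where
    []  : ∀ {x} → Walk 0 x x
    _∷_ : ∀ {l x y z} → Adj x y → Walk l y z → Walk (suc l) x z

  lookup : ∀ {l x y} → Walk l x y → Fin (suc l) → V
  lookup {x = x} w       zero    = x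
  lookup         (_ ∷ w) (suc i) = lookup w i

  lookup-adjacent : ∀ {l x y} (w : Walk l x y) (i : Fin l) → Adj (lookup w (inject₁ i)) (lookup w (suc i))
  lookup-adjacent (a ∷ w) zero    = a
  lookup-adjacent (_ ∷ w) (suc i) = lookup-adjacent w i

  lookup-last : ∀ {l x y} (w : Walk l x y) → lookup w (fromℕ l) ≡ y
  lookup-last []      = refl
  lookup-last (_ ∷ w) = lookup-last w

  Within : EdgeSet → ∀ {l x y} → Walk l x y → Set
  Within S []                  = ⊤
  Within S (_∷_ {x = x} {y} _ w) = EdgeIn S x y × Within S w

  within-lookup : ∀ {S l x y} (w : Walk l x y) → Within S w →
                  ∀ i → EdgeIn S (lookup w (inject₁ i)) (lookup w (suc i))
  within-lookup (_ ∷ w) (h , _)  zero    = h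
  within-lookup (_ ∷ w) (_ , hs) (suc i) = within-lookup w hs i

  Simple : ∀ {l x y} → Walk l x y → Set
  Simple []                = ⊤
  Simple (_∷_ {x = x} _ w) = (∀ i → lookup w i ≢ x) × Simple w

  simple-injective : ∀ {l x y} (w : Walk l x y) → Simple w → ∀ {i j} → lookup w i ≡ lookup w j → i ≡ j
  simple-injective w       _              {zero}  {zero}  _  = refl
  simple-injective (_ ∷ w) (fresh , _)    {zero}  {suc j} eq = ⊥-elim (fresh j (sym eq))
  simple-injective (_ ∷ w) (fresh , _)    {suc i} {zero}  eq = ⊥-elim (fresh i eq)
  simple-injective (_ ∷ w) (_ , simple)   {suc i} {suc j} eq = cong suc (simple-injective w simple eq)

  Joins : EdgeSet → V → V → Set
  Joins S x y = ∃[ l ] Σ (Walk l x y) (Within S)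

  JoinsSimply : EdgeSet → V → V → Set
  JoinsSimply S x y = ∃[ l ] Σ (Walk l x y) λ w → Simple w × Within S w

  joins-refl : ∀ {S x} → Joins S x x
  joins-refl = 0 , [] , tt

  joins-∷ : ∀ {S x y z} → Adj x y → EdgeIn S x y → Joins S y z → Joins S x z
  joins-∷ a h (l , w , hs) = suc l , a ∷ w , h , hs

  joins-trans : ∀ {S x y z} → Joins S x y → Joins S y z → Joins S x z
  joins-trans (_ , []    , _)      j = j
  joins-trans (_ , a ∷ w , h , hs) j = joins-∷ a h (joins-trans (_ , w , hs) j)

  joins-sym : ∀ {S x y} → Joins S x y → Joins S y x
  joins-sym (_ , []    , _)      = joins-refl
  joins-sym (_ , a ∷ w , h , hs) =
    joins-trans (joins-sym (_ , w , hs)) (joins-∷ (Adj-sym a) (EdgeIn-swap h) joins-refl)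

  joins-mono : ∀ {S T : EdgeSet} {x y} → (∀ {u v} → S u v → T u v) → Joins S x y → Joins T x y
  joins-mono S⊆T (_ , []    , _)      = joins-refl
  joins-mono S⊆T (_ , a ∷ w , h , hs) = joins-∷ a (S⊆T ∘ h) (joins-mono S⊆T (_ , w , hs))

  private
    drop-until : ∀ {S l x y z} (w : Walk l x y) → Simple w → Within S w → ∀ i → lookup w i ≡ z → JoinsSimply S z y
    drop-until w       simple       within       zero    refl = _ , w , simple , within
    drop-until (_ ∷ w) (_ , simple) (_ , within) (suc i) eq   = drop-until w simple within i eq

  shortcut : ExcludedMiddle 0ℓ → ∀ {S x y} → Joins S x y → JoinsSimply S x y
  shortcut em (_ , [] , _) = _ , [] , tt , tt
  shortcut em {x = x} (_ , a ∷ w , h , hs) with shortcut em (_ , w , hs)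
  ... | m , s , simple , within with em {∃[ i ] lookup s i ≡ x}
  ...   | yes (i , s[i]≡x) = drop-until s simple within i s[i]≡x
  ...   | no fresh = suc m , a ∷ s , ((λ i eq → fresh (i , eq)) , simple) , h , within

  cycle-through-edge : ExcludedMiddle 0ℓ → ∀ {S x y} → Adj x y → Joins S y x →
    (∀ {u v} → S u v → ¬ SameEdge G x y u v) →
    Σ (Cycle G) λ D → CycleEdge G D x y × (∀ {u v} → CycleEdge G D u v → S u v ⊎ SameEdge G x y u v)
  cycle-through-edge em {S} {x} {y} xy j avoids with shortcut em j
  ... | 0 , [] , _ = ⊥-elim (irrefl x xy)
  ... | 1 , _ ∷ [] , _ , h , _ = ⊥-elim (avoids (h same-edge-refl) (inj₂ (refl , refl)))
  ... | suc (suc k) , s , simple , within =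
    D , inj₂ (subst (λ z → SameEdge G z y x y) (sym (lookup-last s)) same-edge-refl) , classify
    where
    D : Cycle G
    D = record { k = k ; vtx = lookup s ; inj = simple-injective s simple ; adj = lookup-adjacent s
               ; close = subst (λ z → Adj z y) (sym (lookup-last s)) xy }
    classify : ∀ {u v} → CycleEdge G D u v → S u v ⊎ SameEdge G x y u v
    classify (inj₁ (i , e)) = inj₁ (within-lookup s within i e)
    classify {u} {v} (inj₂ e) = inj₂ (subst (λ z → SameEdge G z y u v) (lookup-last s) e)

module CycleIndexing (G : Graph) (D : Cycle G) where

  open Graph G using (V; Adj)
  open Walks G
  open Cycle D

  n : ℕ
  n = suc (suc (suc k))

  -- opaque, so that unification does not unfold _%_ at the concrete length n
  opaque
    vertex : ℕ → V
    vertex m = vtx (m mod n)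

  Edge : ℕ → EdgeSet
  Edge t = SameEdge G (vertex t) (vertex (suc t))

  Arc : ℕ → ℕ → EdgeSet
  Arc a b u v = ∃[ t ] a ≤ t × t < b × Edge t u v

  opaque
    unfolding vertex

    vertex-residue : ∀ m (i : Fin n) → toℕ i ≡ m % n → vertex m ≡ vtx i
    vertex-residue m i i≡m = cong vtx (toℕ-injective (trans (toℕ-fromℕ< (m%n<n m n)) (sym i≡m)))

    vertex-%-cong : ∀ {a b} → a % n ≡ b % n → vertex a ≡ vertex b
    vertex-%-cong {a} {b} eq = vertex-residue a (b mod n) (trans (toℕ-fromℕ< (m%n<n b n)) (sym eq))

    vertex-%-injective : ∀ {a b} → vertex a ≡ vertex b → a % n ≡ b % n
    vertex-%-injective {a} {b} eq =
      trans (sym (toℕ-fromℕ< (m%n<n a n))) (trans (cong toℕ (inj eq)) (toℕ-fromℕ< (m%n<n b n)))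

  vertex-toℕ : ∀ {m} (i : Fin n) → toℕ i ≡ m → vertex m ≡ vtx i
  vertex-toℕ i refl = vertex-residue (toℕ i) i (sym (m<n⇒m%n≡m (toℕ<n i)))

  vertex-+n : ∀ a → vertex (a + n) ≡ vertex a
  vertex-+n a = vertex-%-cong ([m+n]%n≡m%n a n)

  vertex-step : ∀ m → (∃[ i ] vertex m ≡ vtx (inject₁ i) × vertex (suc m) ≡ vtx (suc i))
                    ⊎ (vertex m ≡ vtx (fromℕ (suc (suc k))) × vertex (suc m) ≡ vtx zero)
  vertex-step m with m % n <? suc (suc k) | m%n<n m n
  ... | yes r<last | _ =
    inj₁ (i , vertex-residue m (inject₁ i) (trans (toℕ-inject₁ i) i≡r)
            , vertex-residue (suc m) (suc i) (trans (cong suc i≡r) (sym sm≡sr)))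
    where
    i = fromℕ< r<last
    i≡r = toℕ-fromℕ< r<last
    sm≡sr : suc m % n ≡ suc (m % n)
    sm≡sr = trans (suc-%-cong n {m} {m % n} (sym (m%n%n≡m%n m n))) (m<n⇒m%n≡m (s≤s r<last))
  ... | no r≮last | r<n =
    inj₂ (vertex-residue m (fromℕ _) (trans (toℕ-fromℕ _) (sym r≡last)) , vertex-residue (suc m) zero (sym sm≡0))
    where
    r≡last : m % n ≡ suc (suc k)
    r≡last = ≤-antisym (s≤s⁻¹ r<n) (≮⇒≥ r≮last)
    sm≡0 : suc m % n ≡ 0
    sm≡0 = trans (suc-%-cong n {m} {suc (suc k)} (trans (sym (m%n%n≡m%n m n)) (cong (_% n) r≡last))) (n%n≡0 n)

  vertex-adjacent : ∀ m → Adj (vertex m) (vertex (suc m))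
  vertex-adjacent m with vertex-step m
  ... | inj₁ (i , p , q) = subst₂ Adj (sym p) (sym q) (adj i)
  ... | inj₂ (p , q)     = subst₂ Adj (sym p) (sym q) close

  edge⇒cycleEdge : ∀ {t u v} → Edge t u v → CycleEdge G D u v
  edge⇒cycleEdge {t} {u} {v} e with vertex-step t
  ... | inj₁ (i , p , q) = inj₁ (i , subst₂ (λ a b → SameEdge G a b u v) p q e)
  ... | inj₂ (p , q)     = inj₂ (subst₂ (λ a b → SameEdge G a b u v) p q e)

  cycleEdge⇒edge : ∀ {u v} → CycleEdge G D u v → ∃[ t ] Edge t u v
  cycleEdge⇒edge {u} {v} (inj₁ (i , e)) =
    toℕ i , subst₂ (λ x y → SameEdge G x y u v)
              (sym (vertex-toℕ (inject₁ i) (toℕ-inject₁ i))) (sym (vertex-toℕ (suc i) refl)) e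
  cycleEdge⇒edge {u} {v} (inj₂ e) =
    suc (suc k) , subst₂ (λ x y → SameEdge G x y u v)
                    (sym (vertex-toℕ (fromℕ _) (toℕ-fromℕ _))) (sym (trans (vertex-+n 0) (vertex-toℕ zero refl))) e

  edge-%-cong : ∀ {a b u v} → a % n ≡ b % n → Edge a u v → Edge b u v
  edge-%-cong {a} {b} {u} {v} eq =
    subst₂ (λ x y → SameEdge G x y u v) (vertex-%-cong eq) (vertex-%-cong (suc-%-cong n {a} {b} eq))

  -- the flipped case would make vertex a = vertex (a + 2), impossible on a cycle of length at least 3
  edge-%-injective : ∀ {a b u v} → Edge a u v → Edge b u v → a % n ≡ b % n
  edge-%-injective {a} {b} ea eb with same-edge-trans ea (same-edge-sym eb)
  ... | inj₁ (a≡b , _) = vertex-%-injective a≡b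
  ... | inj₂ (a≡sb , sa≡b) = ⊥-elim (%-distinct-on-window n {a} {2 + a} a<2+a 2+a<a+n (sym ssa≡a))
    where
    a<2+a = s≤s (n≤1+n a)
    2+a<a+n = subst (_< a + n) (+-comm a 2) (+-monoʳ-< a (s≤s (s≤s (s≤s z≤n))))
    ssa≡a : suc (suc a) % n ≡ a % n
    ssa≡a = trans (suc-%-cong n {suc a} {b} (vertex-%-injective sa≡b)) (sym (vertex-%-injective a≡sb))

  arc-edge : ∀ {a b u v} → Arc a b u v → CycleEdge G D u v
  arc-edge (_ , _ , _ , e) = edge⇒cycleEdge e

  arc-joins : ∀ {a b} → a ≤ b → Joins (Arc a b) (vertex a) (vertex b)
  arc-joins {a} {b} a≤b = subst (λ c → Joins (Arc a c) (vertex a) (vertex c)) (m∸n+n≡m a≤b) (arc-from (b ∸ a))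
    where
    arc-from : ∀ d → Joins (Arc a (d + a)) (vertex a) (vertex (d + a))
    arc-from zero    = joins-refl
    arc-from (suc d) = joins-trans (joins-mono widen (arc-from d))
                                   (joins-∷ (vertex-adjacent (d + a)) (λ e → d + a , m≤n+m a d , ≤-refl , e) joins-refl)
      where
      widen : ∀ {u v} → Arc a (d + a) u v → Arc a (suc d + a) u v
      widen (t , a≤t , t<d+a , e) = t , a≤t , m<n⇒m<1+n t<d+a , e

  edge-window-distinct : ∀ {c t u v} → c < t → t < c + n → Edge c u v → ¬ Edge t u v
  edge-window-distinct c<t t<c+n ec et = %-distinct-on-window n c<t t<c+n (edge-%-injective ec et)

  arc-around : ∀ m → Joins (λ u v → CycleEdge G D u v × ¬ Edge m u v) (vertex (suc m)) (vertex m)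
  arc-around m =
    joins-mono avoid (subst (Joins (Arc (suc m) (m + n)) (vertex (suc m))) (vertex-+n m) (arc-joins (m<m+n m z<s)))
    where
    avoid : ∀ {u v} → Arc (suc m) (m + n) u v → CycleEdge G D u v × ¬ Edge m u v
    avoid (t , m<t , t<m+n , e) = edge⇒cycleEdge e , λ e' → edge-window-distinct m<t t<m+n e' e

  cycle-minus-edge : ∀ {x y} → CycleEdge G D x y → Joins (λ u v → CycleEdge G D u v × ¬ SameEdge G x y u v) x y
  cycle-minus-edge xy with cycleEdge⇒edge xy
  ... | m , inj₁ (refl , refl) = joins-sym (arc-around m)
  ... | m , inj₂ (refl , refl) = joins-mono (λ (uv , ¬e) → uv , ¬e ∘ same-edge-swap) (arc-around m)

  cycle-vertex : ∀ {x y} → CycleEdge G D x y → ∃[ a ] vertex a ≡ x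
  cycle-vertex xy with cycleEdge⇒edge xy
  ... | m , inj₁ (vm≡x , _)  = m , vm≡x
  ... | m , inj₂ (_ , vsm≡x) = suc m , vsm≡x

  joins-vertices : ∀ a b → Joins (CycleEdge G D) (vertex a) (vertex b)
  joins-vertices a b with %-representative n a b
  ... | b' , a≤b' , _ , b'≡b =
    subst (Joins (CycleEdge G D) (vertex a)) (vertex-%-cong b'≡b) (joins-mono arc-edge (arc-joins a≤b'))

  cycle-connected : ∀ {x y u v} → CycleEdge G D x y → CycleEdge G D u v → Joins (CycleEdge G D) x u
  cycle-connected xy uv with cycle-vertex xy | cycle-vertex uv
  ... | a , refl | b , refl = joins-vertices a b

  module ArcPath {a b : ℕ} (a≤b : a ≤ b) (short : b + 2 ≤ a + n) where

    private
      span : suc (b ∸ a) < n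
      span = +-cancelʳ-≤ a _ n (subst₂ _≤_ (trans (+-comm b 2) (cong (λ m → 2 + m) (sym (m∸n+n≡m a≤b)))) (+-comm a n) short)

      position : Fin (suc (suc (b ∸ a))) → ℕ
      position i = a + toℕ i

      position-in-window : ∀ i → position i < a + n
      position-in-window i = +-monoʳ-< a (≤-<-trans (s≤s⁻¹ (toℕ<n i)) span)

      lower-end : ∀ i → vertex (position (inject₁ i)) ≡ vertex (a + toℕ i)
      lower-end i = cong (λ j → vertex (a + j)) (toℕ-inject₁ i)

      upper-end : ∀ i → vertex (position (suc i)) ≡ vertex (suc (a + toℕ i))
      upper-end i = cong vertex (+-suc a (toℕ i))

    path : Path G
    path = record
      { k   = b ∸ a
      ; vtx = vertex ∘ position
      ; inj = λ {i} {j} eq → toℕ-injective (+-cancelˡ-≡ a _ _ (%-injective-on-window n (m≤m+n a _) (position-in-window i)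
                                                               (m≤m+n a _) (position-in-window j) (vertex-%-injective eq)))
      ; adj = λ i → subst₂ Adj (sym (lower-end i)) (sym (upper-end i)) (vertex-adjacent (a + toℕ i))
      }

    path-edge⇒arc : ∀ {u v} → PathEdge G path u v → Arc a (suc b) u v
    path-edge⇒arc {u} {v} (i , e) =
      a + toℕ i , m≤m+n a _ , s≤s (subst (a + toℕ i ≤_) (m+[n∸m]≡n a≤b) (+-monoʳ-≤ a (s≤s⁻¹ (toℕ<n i)))) ,
      subst₂ (λ x y → SameEdge G x y u v) (lower-end i) (upper-end i) e

    arc⇒path-edge : ∀ {u v} → Arc a (suc b) u v → PathEdge G path u v
    arc⇒path-edge {u} {v} (t , a≤t , t<sb , e) =
      i , subst₂ (λ x y → SameEdge G x y u v) (sym (lower-end i)) (sym (upper-end i)) e'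
      where
      i : Fin (suc (b ∸ a))
      i = fromℕ< (s≤s (∸-monoˡ-≤ a (s≤s⁻¹ t<sb)))
      a+i≡t : a + toℕ i ≡ t
      a+i≡t = trans (cong (a +_) (toℕ-fromℕ< _)) (m+[n∸m]≡n a≤t)
      e' : Edge (a + toℕ i) u v
      e' = subst (λ j → Edge j u v) (sym a+i≡t) e

    path-in-cycle : PathInCycle G path D
    path-in-cycle u v = arc-edge ∘ path-edge⇒arc

module CycleEquivalence (em : ExcludedMiddle 0ℓ) (G : Graph) (C : Cycle G) where

  open Walks G
  open CycleIndexing G C

  private
    dne : ∀ {P : Set} → ¬ ¬ P → P
    dne = em⇒dne em

  R : ℕ → ℕ → Set
  R i j = _∼_ G (vertex i , vertex (suc i)) (vertex j , vertex (suc j))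

  EdgeOf : Cycle G → ℕ → Set
  EdgeOf D i = CycleEdge G D (vertex i) (vertex (suc i))

  edgeOf-%-cong : ∀ D {i j} → i % n ≡ j % n → EdgeOf D i → EdgeOf D j
  edgeOf-%-cong D {i} {j} eq h = cycleEdge-resp D h (same-edge-sym (edge-%-cong {i} {j} eq same-edge-refl))

  not-edgeOf : ∀ D {i u v} → ¬ EdgeOf D i → CycleEdge G D u v → ¬ Edge i u v
  not-edgeOf D ∉D uv e = ∉D (cycleEdge-resp D uv (same-edge-sym e))

  edge-inEC : ∀ {t u v} → Edge t u v → InEC G u v
  edge-inEC {t} e = same-edge-adj (vertex-adjacent t) e , C , edge⇒cycleEdge e

  counterexample : ∀ {i j} → ¬ R i j → Σ (Cycle G) λ D → EdgeOf D i × ¬ EdgeOf D j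
  counterexample ¬rij = dne λ none → ¬rij λ D ei∈D → dne λ ej∉D → none (D , ei∈D , ej∉D)

  R-resp-% : ∀ {i j j'} → j % n ≡ j' % n → R i j → R i j'
  R-resp-% eq rij D ei∈D = edgeOf-%-cong D eq (rij D ei∈D)

  Avoiding : ℕ → ℕ → EdgeSet
  Avoiding i j u v = ¬ Edge i u v × ¬ Edge j u v

  -- Together with e_i, a walk avoiding e_i and e_j between the two arcs of C − e_i − e_j
  -- would close a cycle through e_i that misses e_j.
  separation : ∀ {i j a b} → i < j → j < i + n → R i j → suc i ≤ a → a ≤ j → suc j ≤ b → b ≤ i + n →
               ¬ Joins (Avoiding i j) (vertex a) (vertex b)
  separation {i} {j} {a} {b} i<j j<i+n rij i<a a≤j j<b b≤i+n w =
    absurd (cycle-through-edge em (vertex-adjacent i) loop proj₁)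
    where
    before : ∀ {u v} → Arc (suc i) a u v → Avoiding i j u v
    before (t , i<t , t<a , e) = (λ ei → edge-window-distinct i<t (<-trans t<j j<i+n) ei e)
                               , (λ ej → edge-window-distinct t<j (<-≤-trans j<i+n (+-monoˡ-≤ n (<⇒≤ i<t))) e ej)
      where t<j = <-≤-trans t<a a≤j
    after : ∀ {u v} → Arc b (i + n) u v → Avoiding i j u v
    after (t , b≤t , t<i+n , e) = (λ ei → edge-window-distinct (<-trans i<j j<t) t<i+n ei e)
                                , (λ ej → edge-window-distinct j<t (<-trans t<i+n (+-monoˡ-< n i<j)) ej e)
      where j<t = <-≤-trans j<b b≤t
    loop : Joins (Avoiding i j) (vertex (suc i)) (vertex i)
    loop = joins-trans (joins-mono before (arc-joins i<a))
             (joins-trans w (subst (Joins (Avoiding i j) (vertex b)) (vertex-+n i) (joins-mono after (arc-joins b≤i+n))))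
    absurd : ¬ Σ (Cycle G) λ D → EdgeOf D i × (∀ {u v} → CycleEdge G D u v → Avoiding i j u v ⊎ Edge i u v)
    absurd (D , ei∈D , D⊆) with D⊆ (rij D ei∈D)
    ... | inj₁ (_ , ¬ej) = ¬ej same-edge-refl
    ... | inj₂ ei≡ej     = edge-window-distinct i<j j<i+n ei≡ej same-edge-refl

  R-sym : ∀ {i j} → R i j → R j i
  R-sym {i} {j} rij D ej∈D with em {EdgeOf D i}
  ... | yes ei∈D = ei∈D
  ... | no ei∉D with %-representative n i j
  ...   | j' , i≤j' , j'<i+n , j'≡j with m≤n⇒m<n∨m≡n i≤j'
  ...     | inj₂ refl = ⊥-elim (ei∉D (edgeOf-%-cong D (sym j'≡j) ej∈D))
  ...     | inj₁ i<j' = ⊥-elim (separation i<j' j'<i+n (R-resp-% (sym j'≡j) rij) i<j' ≤-refl ≤-refl j'<i+n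
                          (joins-mono avoid (CycleIndexing.cycle-minus-edge G D (edgeOf-%-cong D (sym j'≡j) ej∈D))))
    where
    avoid : ∀ {u v} → CycleEdge G D u v × ¬ Edge j' u v → Avoiding i j' u v
    avoid (uv , ¬ej') = not-edgeOf D ei∉D uv , ¬ej'

  R-isEquivalence : IsEquivalence R
  R-isEquivalence = record { refl = λ D h → h ; sym = R-sym ; trans = λ rij rjk D h → rjk D (rij D h) }

  noncrossing : ∀ {p r p' s} → p < r → r < p' → p' < s → s < p + n → R p p' → R r s → R r p
  noncrossing {p} {r} {p'} {s} p<r r<p' p'<s s<p+n rpp' rrs = dne λ ¬rrp → crossing (counterexample ¬rrp)
    where
    crossing : ¬ Σ (Cycle G) λ D → EdgeOf D r × ¬ EdgeOf D p
    crossing (D , er∈D , ep∉D) =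
      separation (<-trans p<r r<p') (<-trans p'<s s<p+n) rpp' p<r (<⇒≤ r<p') p'<s (<⇒≤ s<p+n)
        (joins-mono avoid (CycleIndexing.cycle-connected G D er∈D (rrs D er∈D)))
      where
      avoid : ∀ {u v} → CycleEdge G D u v → Avoiding p p' u v
      avoid uv = not-edgeOf D ep∉D uv , not-edgeOf D (λ ep'∈D → ep∉D (R-sym rpp' D ep'∈D)) uv

  open NonCrossing em n R R-isEquivalence R-resp-% noncrossing public using (IntervalClass; two-interval-classes)

  module ClassPath (I : IntervalClass) where

    open IntervalClass I renaming (start to a; end to b)
    open ArcPath start≤end short public using (path; path-in-cycle)
    open ArcPath start≤end short using (path-edge⇒arc; arc⇒path-edge)

    start-edge-on-path : PathEdge G path (vertex a) (vertex (suc a))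
    start-edge-on-path = arc⇒path-edge (a , ≤-refl , s≤s start≤end , same-edge-refl)

    path-edge-equivalent : ∀ {u v} → PathEdge G path u v → _∼_ G (vertex a , vertex (suc a)) (u , v)
    path-edge-equivalent p D ea∈D with path-edge⇒arc p
    ... | t , a≤t , t≤b , e = cycleEdge-resp D (filled a≤t (s≤s⁻¹ t≤b) D ea∈D) e

    path-is-class : PathEquivClass G path
    path-is-class = vertex a , vertex (suc a) , edge-inEC {a} same-edge-refl , λ u v → to , from
      where
      to : ∀ {u v} → PathEdge G path u v → InEC G u v × _∼_ G (vertex a , vertex (suc a)) (u , v)
      to p with path-edge⇒arc p
      ... | _ , _ , _ , e = edge-inEC e , path-edge-equivalent p
      from : ∀ {u v} → InEC G u v × _∼_ G (vertex a , vertex (suc a)) (u , v) → PathEdge G path u v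
      from (_ , ea∼uv) with cycleEdge⇒edge (ea∼uv C (edge⇒cycleEdge {a} same-edge-refl))
      ... | m , e with covers (λ D ea∈D → cycleEdge-resp D (ea∼uv D ea∈D) (same-edge-sym e))
      ...   | t , a≤t , t≤b , t≡m = arc⇒path-edge (t , a≤t , s≤s t≤b , edge-%-cong {m} {t} (sym t≡m) e)

  not-all-equivalent : ¬ CycleEquivClass G C → ∃[ t ] ¬ R 0 t
  not-all-equivalent ¬class =
    dne λ none → ¬class (vertex 0 , vertex 1 , edge-inEC {0} same-edge-refl , λ u v → to none , from)
    where
    to : ¬ (∃[ t ] ¬ R 0 t) → ∀ {u v} → CycleEdge G C u v → InEC G u v × _∼_ G (vertex 0 , vertex 1) (u , v)
    to none uv with cycleEdge⇒edge uv
    ... | m , e = edge-inEC e , λ D e0∈D → cycleEdge-resp D (dne (λ ¬r0m → none (m , ¬r0m)) D e0∈D) e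
    from : ∀ {u v} → InEC G u v × _∼_ G (vertex 0 , vertex 1) (u , v) → CycleEdge G C u v
    from (_ , e0∼uv) = e0∼uv C (edge⇒cycleEdge {0} same-edge-refl)

  paths-of-distinct-classes : (∃₂ λ I J → ¬ R (IntervalClass.start I) (IntervalClass.start J)) →
    ∃[ P₁ ] ∃[ P₂ ] (PathEquivClass G P₁ × PathEquivClass G P₂ ×
      PathInCycle G P₁ C × PathInCycle G P₂ C ×
      ∃[ u ] ∃[ v ] (PathEdge G P₁ u v × ¬ PathEdge G P₂ u v))
  paths-of-distinct-classes (I , J , ¬rIJ) =
    P₁.path , P₂.path , P₁.path-is-class , P₂.path-is-class , P₁.path-in-cycle , P₂.path-in-cycle ,
    _ , _ , P₁.start-edge-on-path , λ e → ¬rIJ (R-sym (P₂.path-edge-equivalent e))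
    where
    module P₁ = ClassPath I
    module P₂ = ClassPath J

lemma12 : ExcludedMiddle 0ℓ → (G : Graph) → (C : Cycle G) →
    ¬ CycleEquivClass G C →
    ∃[ P₁ ] ∃[ P₂ ] (PathEquivClass G P₁ × PathEquivClass G P₂ ×
    PathInCycle G P₁ C × PathInCycle G P₂ C ×
    ∃[ u ] ∃[ v ] (PathEdge G P₁ u v × ¬ PathEdge G P₂ u v))
lemma12 em G C ¬class =
  let open CycleEquivalence em G C
  in paths-of-distinct-classes (two-interval-classes (proj₂ (not-all-equivalent ¬class)))
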